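{- Let $n\geq 2$ and let $\lambda=(\lambda_{\overline{n}},\dots,\lambda_{\overline{1}})$, $\mu=(\mu_{\overline{n}},\dots,\mu_{\overline{1}})$ be dominant weights of type $C_n$ (i.e. partitions with at most $n$ parts) such that $\lambda_{\overline{n}}=\mu_{\overline{n}}$. Put $\lambda'=(\lambda_{\overline{n-1}},\dots,\lambda_{\overline{1}})$ and $\mu'=(\mu_{\overline{n-1}},\dots,\mu_{\overline{1}})$, dominant weights of type $C_{n-1}$. Then $K_{\lambda,\mu}(q)=K_{\lambda',\mu'}(q)$, where the left side is the Kostka–Foulkes polynomial of type $C_n$ and the right side that of type $C_{n-1}$.
   Context: For $N\geq1$ the weight lattice of type $C_N$ is $P_N=\mathbb{Z}^N$ with orthonormal basis $\varepsilon_{\overline{N}},\dots,\varepsilon_{\overline{1}}$; write $\beta=(\beta_{\overline{N}},\dots,\beta_{\overline{1}})$. The positive roots are $R_N^+=\{\varepsilon_{\overline{i}}\pm\varepsilon_{\overline{j}}:1\leq j<i\leq N\}\cup\{2\varepsilon_{\overline{i}}:1\leq i\leq N\}$; dominant weights $P_N^+$ are the $\beta$ with $\beta_{\overline{N}}\geq\dots\geq\beta_{\overline{1}}\geq0$; $\rho=(N,N-1,\dots,1)$. The Weyl group $W_N$ is the group of signed permutations of the coordinates (generated by $s_i$, $1\le i\le N-1$, exchanging the coordinates $\overline{i+1},\overline{i}$, and $s_0$ changing the sign of the coordinate $\overline{1}$), with length function $l$ relative to these generators. With $x^\beta=x_N^{\beta_{\overline N}}\cdots x_1^{\beta_{\overline1}}$,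 the $q$-Kostant partition function is defined by $\prod_{\alpha\in R_N^+}\frac{1}{1-qx^\alpha}=\sum_\beta\mathcal{P}_q(\beta)x^\beta$ ($\mathcal P_q(\beta)=0$ if $\beta$ is not a nonnegative integer combination of positive roots). For $\lambda,\mu\in P_N^+$ the Kostka–Foulkes polynomial is $K_{\lambda,\mu}(q)=\sum_{\sigma\in W_N}(-1)^{l(\sigma)}\mathcal{P}_q(\sigma(\lambda+\rho)-(\mu+\rho))$. -}

module Defs where

open import Data.Nat as ℕ using (ℕ; zero; suc)
open import Data.Integer as ℤ using (ℤ; +_; -_; _+_; _-_; _*_)
open import Data.Fin as Fin using (Fin)
open import Data.Bool using (Bool; true; false; if_then_else_)
open import Data.Product using (_×_; _,_)
open import Data.Unit using (⊤)
open import Data.List as List using (List; []; _∷_; concatMap; length; filterᵇ)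
open import Data.Nat.ListAction using (sum)
open import Data.Bool.ListAction using (any)
open import Data.Vec as Vec using (Vec; []; _∷_; tabulate; lookup; insertAt; zipWith; replicate)
open import Data.Vec.Properties using (≡-dec)
open import Relation.Nullary using (does)

-- A weight β = (β_{N̄}, …, β_{1̄}) ∈ ℤ^N is a  Vec ℤ N  whose head is the
-- coordinate β_{N̄} and whose last entry is β_{1̄}.  Position a : Fin N
-- (0-based, from the left) is the coordinate  \overline{N - a}.

Weight : ℕ → Set
Weight N = Vec ℤ N

Dominant : ∀ {N} → Weight N → Set
Dominant []            = ⊤
Dominant (x ∷ [])      = + 0 ℤ.≤ x
Dominant (x ∷ y ∷ r)   = (y ℤ.≤ x) × Dominant (y ∷ r)

rho : ∀ N → Weight N
rho zero    = []
rho (suc n) = + suc n ∷ rho n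

_⊕_ : ∀ {N} → Weight N → Weight N → Weight N
_⊕_ = zipWith _+_

_⊖_ : ∀ {N} → Weight N → Weight N → Weight N
_⊖_ = zipWith _-_

neg : ∀ {N} → Weight N → Weight N
neg = Vec.map (λ x → - x)

scale : ∀ {N} → ℤ → Weight N → Weight N
scale c = Vec.map (c *_)

unit : ∀ {N} → Fin N → Weight N
unit a = tabulate (λ b → if does (a Fin.≟ b) then + 1 else + 0)

-- Positive roots R_N^+ :  ε_i ± ε_j (i > j)  and  2 ε_i.
-- Index i > j  ⇔  position of i  <  position of j.

posRoots : ∀ N → List (Weight N)
posRoots N =
  concatMap (λ a →
     (scale (+ 2) (unit a)) ∷
     concatMap (λ b → (unit a ⊕ unit b) ∷ (unit a ⊖ unit b) ∷ [])
               (filterᵇ (λ b → does (a Fin.<? b)) (List.allFin N)))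
   (List.allFin N)

-- q-Kostant partition function.  Polynomials in q are represented by
-- their coefficient functions ℕ → ℤ (coefficient of q^k).
--
-- count rs k β = coefficient of q^k x^β in  ∏_{α ∈ rs} 1/(1 - q x^α)
--             = number of multisets of elements of rs of size k summing to β.

count : ∀ {N} → List (Weight N) → ℕ → Weight N → ℕ
count []       zero    β = if does (≡-dec ℤ._≟_ β (replicate _ (+ 0))) then 1 else 0
count []       (suc k) β = 0
count (α ∷ rs) k       β =
  sum (List.map (λ j → count rs (k ℕ.∸ j) (β ⊖ scale (+ j) α)) (List.upTo (suc k)))

KostantQ : ∀ N → Weight N → ℕ → ℤ
KostantQ N β k = + count (posRoots N) k β

-- Weyl group W_N = signed permutations.  An element is a pair (π , s) with
-- π a permutation of the positions and s a vector of signs; it acts by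
--   (σ β)_a = (-1)^{s_a} β_{π a}.

perms : ∀ N → List (Vec (Fin N) N)
perms zero    = [] ∷ []
perms (suc n) =
  concatMap (λ p → List.map (λ i → insertAt (Vec.map Fin.suc p) i Fin.zero)
                            (List.allFin (suc n)))
            (perms n)

signVecs : ∀ N → List (Vec Bool N)
signVecs zero    = [] ∷ []
signVecs (suc n) = concatMap (λ s → (false ∷ s) ∷ (true ∷ s) ∷ []) (signVecs n)

SignedPerm : ℕ → Set
SignedPerm N = Vec (Fin N) N × Vec Bool N

weylGroup : ∀ N → List (SignedPerm N)
weylGroup N = List.cartesianProduct (perms N) (signVecs N)

act : ∀ {N} → SignedPerm N → Weight N → Weight N
act (π , s) β = tabulate (λ a → if lookup s a then - lookup β (lookup π a)
                                              else lookup β (lookup π a))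

isNegRoot : ∀ {N} → Weight N → Bool
isNegRoot {N} v = any (λ α → does (≡-dec ℤ._≟_ v (neg α))) (posRoots N)

len : ∀ {N} → SignedPerm N → ℕ
len {N} σ = length (filterᵇ (λ α → isNegRoot (act σ α)) (posRoots N))

signPow : ℕ → ℤ
signPow zero    = + 1
signPow (suc l) = - signPow l

KF : ∀ N → Weight N → Weight N → ℕ → ℤ
KF N la mu k =
  List.foldr _+_ (+ 0)
    (List.map (λ σ → signPow (len σ) * KostantQ N (act σ (la ⊕ rho N) ⊖ (mu ⊕ rho N)) k)
              (weylGroup N))

{-# OPTIONS --safe #-}
-- Every positive root of C_n has nonnegative ε_{n̄}-coordinate; it is positive exactly for
-- 2ε_{n̄} and ε_{n̄} ± ε_{j̄}, and the remaining roots are those of C_{n−1} padded by a leading 0.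
-- Hence 𝒫_q(β) = 0 when β_{n̄} < 0, and 𝒫_q(0, β′) is the partition function of C_{n−1}.
-- For dominant λ the entries of λ + ρ are positive, and all but the first are smaller than
-- c = λ_{n̄} + n = (μ + ρ)_{n̄}.  So σ(λ + ρ) − (μ + ρ) has negative ε_{n̄}-coordinate unless σ
-- fixes that coordinate with sign +.  Those σ form W_{n−1}, with the same length and the same
-- partition function values, which leaves exactly the alternating sum for K_{λ′,μ′}.

module Submission where

open import Defs
open import Data.Nat using (ℕ; suc; _≤_)
open import Data.Integer using (ℤ)
open import Data.Vec using (Vec; head; tail)
open import Relation.Binary.PropositionalEquality using (_≡_)

open import Data.Bool using (Bool; true; false; if_then_else_; _∨_)
open import Data.Bool.ListAction using (any)
open import Data.Fin as Fin using (Fin)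
open import Data.Integer as ℤ using (+_; +[1+_]; -_; _+_; _-_; _*_)
import Data.Integer.Properties as ℤ
open import Data.List as List using (List; []; _∷_; _++_; concatMap; filterᵇ; length)
import Data.List.Properties as List
open import Data.List.Relation.Unary.All as All using (All; []; _∷_)
import Data.List.Relation.Unary.All.Properties as All
open import Data.Nat.ListAction using (sum)
open import Data.Nat as ℕ using (zero)
import Data.Nat.Properties as ℕ
open import Data.Product using (_×_; _,_)
open import Data.Vec as Vec using ([]; _∷_)
import Data.Vec.Properties as Vec
open import Function using (_∘_)
open import Relation.Binary.PropositionalEquality
  using (refl; sym; trans; cong; cong₂; subst; _≗_; module ≡-Reasoning)
open import Relation.Nullary.Decidable using (does; dec-false)

private
  variable
    A B : Set

sumBy : (A → ℤ) → List A → ℤ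
sumBy f xs = List.foldr _+_ (+ 0) (List.map f xs)

sumBy-cong : ∀ {f g : A → ℤ} → f ≗ g → ∀ xs → sumBy f xs ≡ sumBy g xs
sumBy-cong f≗g xs = cong (List.foldr _+_ (+ 0)) (List.map-cong f≗g xs)

sumBy-zero : ∀ {f : A → ℤ} {xs} → All (λ x → f x ≡ + 0) xs → sumBy f xs ≡ + 0
sumBy-zero []             = refl
sumBy-zero (fx≡0 ∷ fxs≡0) = cong₂ _+_ fx≡0 (sumBy-zero fxs≡0)

sumBy-map : ∀ (f : B → ℤ) (g : A → B) xs → sumBy f (List.map g xs) ≡ sumBy (f ∘ g) xs
sumBy-map f g xs = cong (List.foldr _+_ (+ 0)) (sym (List.map-∘ xs))

sumBy-++ : ∀ (f : A → ℤ) xs ys → sumBy f (xs ++ ys) ≡ sumBy f xs + sumBy f ys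
sumBy-++ f []       ys = sym (ℤ.+-identityˡ _)
sumBy-++ f (x ∷ xs) ys = trans (cong (_+_ (f x)) (sumBy-++ f xs ys)) (sym (ℤ.+-assoc (f x) _ _))

sumBy-concatMap : ∀ (f : B → ℤ) (g : A → List B) xs →
                  sumBy f (concatMap g xs) ≡ sumBy (sumBy f ∘ g) xs
sumBy-concatMap f g []       = refl
sumBy-concatMap f g (x ∷ xs) =
  trans (sumBy-++ f (g x) _) (cong (_+_ (sumBy f (g x))) (sumBy-concatMap f g xs))

sumBy-cartesianProduct : ∀ (f : A × B → ℤ) xs ys →
  sumBy f (List.cartesianProduct xs ys) ≡ sumBy (λ x → sumBy (λ y → f (x , y)) ys) xs
sumBy-cartesianProduct f []       ys = refl
sumBy-cartesianProduct f (x ∷ xs) ys = begin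
    sumBy f (List.map (x ,_) ys ++ List.cartesianProduct xs ys)
  ≡⟨ sumBy-++ f (List.map (x ,_) ys) _ ⟩
    sumBy f (List.map (x ,_) ys) + sumBy f (List.cartesianProduct xs ys)
  ≡⟨ cong₂ _+_ (sumBy-map f (x ,_) ys) (sumBy-cartesianProduct f xs ys) ⟩
    sumBy (λ y → f (x , y)) ys + sumBy (λ x → sumBy (λ y → f (x , y)) ys) xs ∎
  where open ≡-Reasoning

-- W_m as the stabiliser of the leading coordinate in W_{m+1}

embed : ∀ {m} → SignedPerm m → SignedPerm (suc m)
embed (π , s) = Fin.zero ∷ Vec.map Fin.suc π , false ∷ s

act-embed : ∀ {m} (σ : SignedPerm m) x v → act (embed σ) (x ∷ v) ≡ x ∷ act σ v
act-embed (π , s) x v = cong (x ∷_) (Vec.tabulate-cong λ a →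
  cong (λ i → if Vec.lookup s a then - Vec.lookup (x ∷ v) i else Vec.lookup (x ∷ v) i)
       (Vec.lookup-map a Fin.suc π))

sumBy-signVecs-suc : ∀ {m} (f : Vec Bool (suc m) → ℤ) → (∀ s → f (true ∷ s) ≡ + 0) →
                     sumBy f (signVecs (suc m)) ≡ sumBy (λ s → f (false ∷ s)) (signVecs m)
sumBy-signVecs-suc {m} f f-true≡0 =
  trans (sumBy-concatMap f _ (signVecs m))
        (sumBy-cong (λ s → trans (cong (λ y → f (false ∷ s) + (y + + 0)) (f-true≡0 s))
                                 (ℤ.+-identityʳ _))
                    (signVecs m))

sumBy-perms-suc : ∀ {m} (f : Vec (Fin (suc m)) (suc m) → ℤ) → (∀ j π → f (Fin.suc j ∷ π) ≡ + 0) →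
                  sumBy f (perms (suc m)) ≡ sumBy (λ π → f (Fin.zero ∷ Vec.map Fin.suc π)) (perms m)
sumBy-perms-suc {m} f f-suc≡0 =
  trans (sumBy-concatMap f _ (perms m)) (sumBy-cong insertions (perms m))
  where
    insert : Vec (Fin m) m → Fin (suc m) → Vec (Fin (suc m)) (suc m)
    insert π i = Vec.insertAt (Vec.map Fin.suc π) i Fin.zero

    insert-suc≡0 : ∀ π i → f (insert π (Fin.suc i)) ≡ + 0
    insert-suc≡0 (j ∷ π) i = f-suc≡0 j _

    insertions : ∀ π → sumBy f (List.map (insert π) (List.allFin (suc m)))
                     ≡ f (Fin.zero ∷ Vec.map Fin.suc π)
    insertions π = trans (cong (_+_ (f (insert π Fin.zero)))
                               (sumBy-zero (All.map⁺ (All.tabulate⁺ (insert-suc≡0 π)))))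
                         (ℤ.+-identityʳ _)

sumBy-weylGroup-suc : ∀ {m} (f : SignedPerm (suc m) → ℤ) →
  (∀ π s → f (π , true ∷ s) ≡ + 0) → (∀ j π s → f (Fin.suc j ∷ π , false ∷ s) ≡ + 0) →
  sumBy f (weylGroup (suc m)) ≡ sumBy (f ∘ embed) (weylGroup m)
sumBy-weylGroup-suc {m} f flip≡0 move≡0 = begin
    sumBy f (weylGroup (suc m))
  ≡⟨ sumBy-cartesianProduct f (perms (suc m)) (signVecs (suc m)) ⟩
    sumBy (λ π → sumBy (λ s → f (π , s)) (signVecs (suc m))) (perms (suc m))
  ≡⟨ sumBy-cong (λ π → sumBy-signVecs-suc _ (flip≡0 π)) (perms (suc m)) ⟩
    sumBy (λ π → sumBy (λ s → f (π , false ∷ s)) (signVecs m)) (perms (suc m))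
  ≡⟨ sumBy-perms-suc _ (λ j π → sumBy-zero (All.universal (move≡0 j π) (signVecs m))) ⟩
    sumBy (λ π → sumBy (λ s → f (embed (π , s))) (signVecs m)) (perms m)
  ≡⟨ sumBy-cartesianProduct (f ∘ embed) (perms m) (signVecs m) ⟨
    sumBy (f ∘ embed) (weylGroup m) ∎
  where open ≡-Reasoning

HeadPos : ∀ {m} → Weight (suc m) → Set
HeadPos α = + 0 ℤ.< head α

HeadNonNeg : ∀ {m} → Weight (suc m) → Set
HeadNonNeg α = + 0 ℤ.≤ head α

rootPair : ∀ {N} → Fin N → Fin N → List (Weight N)
rootPair a b = (unit a ⊕ unit b) ∷ (unit a ⊖ unit b) ∷ []

rootsLedBy : ∀ N → Fin N → List (Weight N)
rootsLedBy N a =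
  scale (+ 2) (unit a) ∷ concatMap (rootPair a) (filterᵇ (does ∘ (a Fin.<?_)) (List.allFin N))

leadingRoots : ∀ m → List (Weight (suc m))
leadingRoots m = rootsLedBy (suc m) Fin.zero

tabulate-suc : ∀ m → List.tabulate {n = m} Fin.suc ≡ List.map Fin.suc (List.allFin m)
tabulate-suc m = sym (List.map-tabulate (λ i → i) Fin.suc)

rootPairs-suc : ∀ {m} (a : Fin m) bs →
  concatMap (rootPair (Fin.suc a)) (filterᵇ (does ∘ (Fin.suc a Fin.<?_)) (List.map Fin.suc bs))
  ≡ List.map (+ 0 ∷_) (concatMap (rootPair a) (filterᵇ (does ∘ (a Fin.<?_)) bs))
rootPairs-suc a []       = refl
rootPairs-suc a (b ∷ bs) with does (a Fin.<? b)
... | true  = cong (λ rs → _ ∷ _ ∷ rs) (rootPairs-suc a bs)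
... | false = rootPairs-suc a bs

rootsLedBy-suc : ∀ m (a : Fin m) → rootsLedBy (suc m) (Fin.suc a) ≡ List.map (+ 0 ∷_) (rootsLedBy m a)
rootsLedBy-suc m a = cong ((+ 0 ∷ scale (+ 2) (unit a)) ∷_)
  (trans (cong (concatMap (rootPair (Fin.suc a)) ∘ filterᵇ (does ∘ (Fin.suc a Fin.<?_)))
               (tabulate-suc m))
         (rootPairs-suc a (List.allFin m)))

posRoots-suc : ∀ m → posRoots (suc m) ≡ leadingRoots m ++ List.map (+ 0 ∷_) (posRoots m)
posRoots-suc m = cong (leadingRoots m ++_) (begin
    concatMap (rootsLedBy (suc m)) (List.tabulate Fin.suc)
  ≡⟨ cong (concatMap (rootsLedBy (suc m))) (tabulate-suc m) ⟩
    concatMap (rootsLedBy (suc m)) (List.map Fin.suc (List.allFin m))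
  ≡⟨ List.concatMap-map (rootsLedBy (suc m)) Fin.suc (List.allFin m) ⟩
    concatMap (rootsLedBy (suc m) ∘ Fin.suc) (List.allFin m)
  ≡⟨ List.concatMap-cong (rootsLedBy-suc m) (List.allFin m) ⟩
    concatMap (List.map (+ 0 ∷_) ∘ rootsLedBy m) (List.allFin m)
  ≡⟨ List.map-concatMap (+ 0 ∷_) (rootsLedBy m) (List.allFin m) ⟨
    List.map (+ 0 ∷_) (posRoots m) ∎)
  where open ≡-Reasoning

leadingRoots-headPos : ∀ m → All HeadPos (leadingRoots m)
leadingRoots-headPos m =
  ℤ.+<+ ℕ.z<s ∷ subst (All HeadPos ∘ pairsWith) (sym (tabulate-suc m)) (pairs-headPos (List.allFin m))
  where
    pairsWith : List (Fin (suc m)) → List (Weight (suc m))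
    pairsWith = concatMap (rootPair Fin.zero) ∘ filterᵇ (does ∘ (Fin.zero {m} Fin.<?_))

    pairs-headPos : ∀ bs → All (HeadPos {m}) (pairsWith (List.map Fin.suc bs))
    pairs-headPos []       = []
    pairs-headPos (b ∷ bs) = ℤ.+<+ ℕ.z<s ∷ ℤ.+<+ ℕ.z<s ∷ pairs-headPos bs

map-zero∷-headNonNeg : ∀ {m} (rs : List (Weight m)) → All HeadNonNeg (List.map (+ 0 ∷_) rs)
map-zero∷-headNonNeg rs = All.map⁺ (All.universal (λ _ → ℤ.≤-refl) rs)

posRoots-headNonNeg : ∀ m → All HeadNonNeg (posRoots (suc m))
posRoots-headNonNeg m = subst (All HeadNonNeg) (sym (posRoots-suc m))
  (All.++⁺ (All.map ℤ.<⇒≤ (leadingRoots-headPos m)) (map-zero∷-headNonNeg (posRoots m)))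

sum-map-zero : ∀ (f : A → ℕ) {xs} → All (λ x → f x ≡ 0) xs → sum (List.map f xs) ≡ 0
sum-map-zero f []           = refl
sum-map-zero f (fx≡0 ∷ fxs≡0) = cong₂ ℕ._+_ fx≡0 (sum-map-zero f fxs≡0)

i<j⇒i-j<0 : ∀ {i j} → i ℤ.< j → i - j ℤ.< + 0
i<j⇒i-j<0 {i} {j} i<j = subst (i - j ℤ.<_) (ℤ.+-inverseʳ j) (ℤ.+-monoˡ-< (- j) i<j)

⊖-scale-zero : ∀ {n} (v w : Weight n) → v ⊖ scale (+ 0) w ≡ v
⊖-scale-zero []      []      = refl
⊖-scale-zero (x ∷ v) (_ ∷ w) = cong₂ _∷_ (ℤ.+-identityʳ x) (⊖-scale-zero v w)

count-head-neg : ∀ {m} {rs : List (Weight (suc m))} → All HeadNonNeg rs →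
                 ∀ k β → head β ℤ.< + 0 → count rs k β ≡ 0
count-head-neg [] zero β β₀<0 =
  cong (λ b → if b then 1 else 0)
       (dec-false (Vec.≡-dec ℤ._≟_ β (Vec.replicate _ (+ 0)))
                  (λ β≡0 → ℤ.<⇒≢ β₀<0 (cong head β≡0)))
count-head-neg [] (suc k) β β₀<0 = refl
count-head-neg {rs = (a ∷ α) ∷ rs} (0≤a ∷ rs≥0) k (b ∷ β) b<0 =
  sum-map-zero _ (All.universal (λ j →
    count-head-neg rs≥0 (k ℕ.∸ j) _ (i<j⇒i-j<0 (ℤ.<-≤-trans b<0 (0≤j*a j)))) (List.upTo (suc k)))
  where
    0≤j*a : ∀ j → + 0 ℤ.≤ + j * a
    0≤j*a j = subst (ℤ._≤ + j * a) (ℤ.*-zeroʳ (+ j)) (ℤ.*-monoˡ-≤-nonNeg (+ j) 0≤a)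

count-skip-headPos : ∀ {m} {α : Weight (suc m)} {rs} → HeadPos α → All HeadNonNeg rs →
                     ∀ k β → count (α ∷ rs) k (+ 0 ∷ β) ≡ count rs k (+ 0 ∷ β)
count-skip-headPos {α = +[1+ a ] ∷ α} {rs} (ℤ.+<+ _) rs≥0 k β = begin
    term 0 ℕ.+ sum (List.map term (List.applyUpTo suc k))
  ≡⟨ cong₂ ℕ._+_ (cong (count rs k) (⊖-scale-zero (+ 0 ∷ β) (+[1+ a ] ∷ α)))
                 (sum-map-zero term (All.applyUpTo⁺₂ suc k λ i →
                   count-head-neg rs≥0 (k ℕ.∸ suc i) _ (ℤ.neg-mono-< (ℤ.+<+ ℕ.z<s)))) ⟩
    count rs k (+ 0 ∷ β) ℕ.+ 0
  ≡⟨ ℕ.+-identityʳ _ ⟩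
    count rs k (+ 0 ∷ β) ∎
  where
    open ≡-Reasoning
    term : ℕ → ℕ
    term j = count rs (k ℕ.∸ j) ((+ 0 ∷ β) ⊖ scale (+ j) (+[1+ a ] ∷ α))

count-skip-headPos-++ : ∀ {m} {B rs : List (Weight (suc m))} → All HeadPos B → All HeadNonNeg rs →
                        ∀ k β → count (B ++ rs) k (+ 0 ∷ β) ≡ count rs k (+ 0 ∷ β)
count-skip-headPos-++ []                     rs≥0 k β = refl
count-skip-headPos-++ (α>0 ∷ B>0) rs≥0 k β =
  trans (count-skip-headPos α>0 (All.++⁺ (All.map ℤ.<⇒≤ B>0) rs≥0) k β)
        (count-skip-headPos-++ B>0 rs≥0 k β)

count-map-zero∷ : ∀ {m} (rs : List (Weight m)) k β →
                  count (List.map (+ 0 ∷_) rs) k (+ 0 ∷ β) ≡ count rs k β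
count-map-zero∷ []       zero    β = refl
count-map-zero∷ []       (suc k) β = refl
count-map-zero∷ (α ∷ rs) k       β = cong sum (List.map-cong (λ j →
  trans (cong (λ x → count (List.map (+ 0 ∷_) rs) (k ℕ.∸ j) ((+ 0 - x) ∷ (β ⊖ scale (+ j) α)))
              (ℤ.*-zeroʳ (+ j)))
        (count-map-zero∷ rs (k ℕ.∸ j) (β ⊖ scale (+ j) α))) (List.upTo (suc k)))

KostantQ-head-neg : ∀ m β k → head β ℤ.< + 0 → KostantQ (suc m) β k ≡ + 0
KostantQ-head-neg m β k β₀<0 = cong +_ (count-head-neg (posRoots-headNonNeg m) k β β₀<0)

KostantQ-zero∷ : ∀ m β k → KostantQ (suc m) (+ 0 ∷ β) k ≡ KostantQ m β k
KostantQ-zero∷ m β k = cong +_ (begin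
    count (posRoots (suc m)) k (+ 0 ∷ β)
  ≡⟨ cong (λ rs → count rs k (+ 0 ∷ β)) (posRoots-suc m) ⟩
    count (leadingRoots m ++ List.map (+ 0 ∷_) (posRoots m)) k (+ 0 ∷ β)
  ≡⟨ count-skip-headPos-++ (leadingRoots-headPos m) (map-zero∷-headNonNeg (posRoots m)) k β ⟩
    count (List.map (+ 0 ∷_) (posRoots m)) k (+ 0 ∷ β)
  ≡⟨ count-map-zero∷ (posRoots m) k β ⟩
    count (posRoots m) k β ∎)
  where open ≡-Reasoning

module _ (p : A → Bool) where

  any-none : ∀ {xs} → All (λ x → p x ≡ false) xs → any p xs ≡ false
  any-none []             = refl
  any-none (px≡f ∷ pxs≡f) = cong₂ _∨_ px≡f (any-none pxs≡f)

  any-++-map : ∀ {xs} (f : B → A) {q : B → Bool} →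
               All (λ x → p x ≡ false) xs → (∀ y → p (f y) ≡ q y) →
               ∀ ys → any p (xs ++ List.map f ys) ≡ any q ys
  any-++-map f []             pf≗q ys =
    cong (List.foldr _∨_ false) (trans (sym (List.map-∘ ys)) (List.map-cong pf≗q ys))
  any-++-map f (px≡f ∷ pxs≡f) pf≗q ys = cong₂ _∨_ px≡f (any-++-map f pxs≡f pf≗q ys)

  length-filterᵇ-++-map : ∀ {xs} (f : B → A) {q : B → Bool} →
                          All (λ x → p x ≡ false) xs → (∀ y → p (f y) ≡ q y) →
                          ∀ ys → length (filterᵇ p (xs ++ List.map f ys)) ≡ length (filterᵇ q ys)
  length-filterᵇ-++-map {xs = x ∷ xs} f (px≡f ∷ pxs≡f) pf≗q ys rewrite px≡f =
    length-filterᵇ-++-map f pxs≡f pf≗q ys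
  length-filterᵇ-++-map {xs = []} f []             pf≗q []       = refl
  length-filterᵇ-++-map {xs = []} f {q} []         pf≗q (y ∷ ys) rewrite pf≗q y with q y
  ... | true  = cong suc (length-filterᵇ-++-map f [] pf≗q ys)
  ... | false = length-filterᵇ-++-map f [] pf≗q ys

equalsNeg : ∀ {N} → Weight N → Weight N → Bool
equalsNeg w α = does (Vec.≡-dec ℤ._≟_ w (neg α))

equalsNeg-false : ∀ {m} {w α : Weight (suc m)} → + 0 ℤ.< head w + head α → equalsNeg w α ≡ false
equalsNeg-false {w = w₀ ∷ w} {α₀ ∷ α} 0<w₀+α₀ =
  dec-false (Vec.≡-dec ℤ._≟_ (w₀ ∷ w) (neg (α₀ ∷ α))) λ w≡-α →
    ℤ.<⇒≢ 0<w₀+α₀ (sym (trans (cong (ℤ._+ α₀) (cong head w≡-α)) (ℤ.+-inverseˡ α₀)))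

isNegRoot-headPos : ∀ {m} (w : Weight (suc m)) → HeadPos w → isNegRoot w ≡ false
isNegRoot-headPos {m} w w₀>0 = any-none (equalsNeg w)
  (All.map (λ {α} α₀≥0 → equalsNeg-false {w = w} {α} (ℤ.+-mono-<-≤ w₀>0 α₀≥0)) (posRoots-headNonNeg m))

isNegRoot-zero∷ : ∀ {m} (v : Weight m) → isNegRoot (+ 0 ∷ v) ≡ isNegRoot v
isNegRoot-zero∷ {m} v = trans (cong (any (equalsNeg (+ 0 ∷ v))) (posRoots-suc m))
  (any-++-map (equalsNeg (+ 0 ∷ v)) (+ 0 ∷_)
    (All.map (λ {α} α₀>0 → equalsNeg-false {w = + 0 ∷ v} {α} (ℤ.+-mono-≤-< (ℤ.≤-refl {+ 0}) α₀>0))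
             (leadingRoots-headPos m))
    -- −(0 ∷ α) computes to 0 ∷ −α, and the test on a cons reduces to the test on the tails.
    (λ _ → refl) (posRoots m))

len-embed : ∀ {m} (σ : SignedPerm m) → len (embed σ) ≡ len σ
len-embed {m} σ = trans (cong (length ∘ filterᵇ flipsRoot) (posRoots-suc m))
  (length-filterᵇ-++-map flipsRoot (+ 0 ∷_)
     (All.map (λ {α} → leading-unflipped {α}) (leadingRoots-headPos m)) zero∷-flips (posRoots m))
  where
    flipsRoot : Weight (suc m) → Bool
    flipsRoot α = isNegRoot (act (embed σ) α)

    leading-unflipped : ∀ {α} → HeadPos α → flipsRoot α ≡ false
    leading-unflipped {a ∷ α} a>0 =
      trans (cong isNegRoot (act-embed σ a α)) (isNegRoot-headPos (a ∷ act σ α) a>0)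

    zero∷-flips : ∀ α → flipsRoot (+ 0 ∷ α) ≡ isNegRoot (act σ α)
    zero∷-flips α = trans (cong isNegRoot (act-embed σ (+ 0) α)) (isNegRoot-zero∷ (act σ α))

dominant-nonNeg : ∀ {N} {v : Weight N} → Dominant v → ∀ i → + 0 ℤ.≤ Vec.lookup v i
dominant-nonNeg {v = x ∷ []}    0≤x       Fin.zero    = 0≤x
dominant-nonNeg {v = x ∷ y ∷ v} (y≤x , d) Fin.zero    = ℤ.≤-trans (dominant-nonNeg d Fin.zero) y≤x
dominant-nonNeg {v = x ∷ y ∷ v} (y≤x , d) (Fin.suc i) = dominant-nonNeg d i

dominant-≤-head : ∀ {n} {x} {v : Weight n} → Dominant (x ∷ v) → ∀ i → Vec.lookup v i ℤ.≤ x
dominant-≤-head {v = y ∷ v} (y≤x , d) Fin.zero    = y≤x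
dominant-≤-head {v = y ∷ v} (y≤x , d) (Fin.suc i) = ℤ.≤-trans (dominant-≤-head d i) y≤x

rho-positive : ∀ N i → + 0 ℤ.< Vec.lookup (rho N) i
rho-positive (suc n) Fin.zero    = ℤ.+<+ ℕ.z<s
rho-positive (suc n) (Fin.suc i) = rho-positive n i

rho-≤ : ∀ N i → Vec.lookup (rho N) i ℤ.≤ + N
rho-≤ (suc n) Fin.zero    = ℤ.≤-refl
rho-≤ (suc n) (Fin.suc i) = ℤ.≤-trans (rho-≤ n i) (ℤ.+≤+ (ℕ.n≤1+n n))

dominant+rho-positive : ∀ {N} {la : Weight N} → Dominant la → ∀ i → + 0 ℤ.< Vec.lookup (la ⊕ rho N) i
dominant+rho-positive {N} {la} d i rewrite Vec.lookup-zipWith _+_ i la (rho N) =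
  ℤ.+-mono-≤-< (dominant-nonNeg d i) (rho-positive N i)

dominant+rho-<-head : ∀ {m} {x} {la : Weight m} → Dominant (x ∷ la) →
                      ∀ i → Vec.lookup (la ⊕ rho m) i ℤ.< x + + suc m
dominant+rho-<-head {m} {x} {la} d i rewrite Vec.lookup-zipWith _+_ i la (rho m) =
  ℤ.+-mono-≤-< (dominant-≤-head d i) (ℤ.≤-<-trans (rho-≤ m i) (ℤ.+<+ (ℕ.n<1+n m)))

KFterm : ∀ N → Weight N → Weight N → ℕ → SignedPerm N → ℤ
KFterm N la mu k σ = signPow (len σ) * KostantQ N (act σ (la ⊕ rho N) ⊖ (mu ⊕ rho N)) k

KFterm-vanish : ∀ {m} (la mu : Weight (suc m)) k σ →
  head (act σ (la ⊕ rho (suc m))) ℤ.< head (mu ⊕ rho (suc m)) → KFterm (suc m) la mu k σ ≡ + 0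
KFterm-vanish {m} (x ∷ la) (y ∷ mu) k σ lt =
  trans (cong (signPow (len σ) *_) (KostantQ-head-neg m _ k (i<j⇒i-j<0 lt)))
        (ℤ.*-zeroʳ (signPow (len σ)))

KFterm-embed : ∀ {m} x (la mu : Weight m) k σ →
               KFterm (suc m) (x ∷ la) (x ∷ mu) k (embed σ) ≡ KFterm m la mu k σ
KFterm-embed {m} x la mu k σ = cong₂ (λ l K → signPow l * K) (len-embed σ) (begin
    KostantQ (suc m) (act (embed σ) (c ∷ (la ⊕ rho m)) ⊖ (c ∷ (mu ⊕ rho m))) k
  ≡⟨ cong (λ v → KostantQ (suc m) (v ⊖ (c ∷ (mu ⊕ rho m))) k) (act-embed σ c (la ⊕ rho m)) ⟩
    KostantQ (suc m) ((c - c) ∷ (act σ (la ⊕ rho m) ⊖ (mu ⊕ rho m))) k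
  ≡⟨ cong (λ c₀ → KostantQ (suc m) (c₀ ∷ (act σ (la ⊕ rho m) ⊖ (mu ⊕ rho m))) k) (ℤ.+-inverseʳ c) ⟩
    KostantQ (suc m) (+ 0 ∷ (act σ (la ⊕ rho m) ⊖ (mu ⊕ rho m))) k
  ≡⟨ KostantQ-zero∷ m _ k ⟩
    KostantQ m (act σ (la ⊕ rho m) ⊖ (mu ⊕ rho m)) k ∎)
  where
    open ≡-Reasoning
    c : ℤ
    c = x + + suc m

mainTheorem1 : (m : ℕ) → 1 ≤ m → (λ′ μ′ : Vec ℤ (suc m))
    → Dominant λ′ → Dominant μ′ → head λ′ ≡ head μ′
    → (k : ℕ) → KF (suc m) λ′ μ′ k ≡ KF m (tail λ′) (tail μ′) k
mainTheorem1 m _ (x ∷ λ′) (.x ∷ μ′) dom-λ _ refl k = begin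
    sumBy (KFterm (suc m) (x ∷ λ′) (x ∷ μ′) k) (weylGroup (suc m))
  ≡⟨ sumBy-weylGroup-suc _ flip≡0 move≡0 ⟩
    sumBy (KFterm (suc m) (x ∷ λ′) (x ∷ μ′) k ∘ embed) (weylGroup m)
  ≡⟨ sumBy-cong (KFterm-embed x λ′ μ′ k) (weylGroup m) ⟩
    sumBy (KFterm m λ′ μ′ k) (weylGroup m) ∎
  where
    open ≡-Reasoning
    flip≡0 : ∀ π s → KFterm (suc m) (x ∷ λ′) (x ∷ μ′) k (π , true ∷ s) ≡ + 0
    flip≡0 π s = KFterm-vanish (x ∷ λ′) (x ∷ μ′) k (π , true ∷ s)
      (ℤ.<-trans (ℤ.neg-mono-< (dominant+rho-positive dom-λ (Vec.lookup π Fin.zero)))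
                 (dominant+rho-positive dom-λ Fin.zero))
    move≡0 : ∀ j π s → KFterm (suc m) (x ∷ λ′) (x ∷ μ′) k (Fin.suc j ∷ π , false ∷ s) ≡ + 0
    move≡0 j π s = KFterm-vanish (x ∷ λ′) (x ∷ μ′) k (Fin.suc j ∷ π , false ∷ s)
                                 (dominant+rho-<-head dom-λ j)
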